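{- Let $T$ be a finite tree and let $H$ be a hub labeling of $T$ produced by a recursive decomposition (as in the context) which is optimal for HL$_1$, i.e. $\sum_u|H_u|$ is minimum among all hub labelings of $T$. For any two vertices $u,v$ with $u\prec v$, we have $M_u\ge M_v$.
   Context: For a tree $T=(V,E)$ and $u,v\in V$, let $P_{uv}$ be the vertex set of the unique $u$–$v$ path. A hub labeling of $T$ is a family $\{H_u\}_{u\in V}$ of subsets of $V$ with $H_u\cap H_v\cap P_{uv}\neq\varnothing$ for all $u,v\in V$ (including $u=v$); HL$_1$ minimizes $\sum_u|H_u|$. A recursive decomposition builds a hub labeling as follows: when processing a subtree $T'$ (starting with $T'=T$), choose a vertex $r\in T'$, add $r$ to $H_v$ for every $v\in T'$, and recursively process each connected component of $T'-r$. Such labelings are hierarchical (the relation $u\preceq v$ iff $u\in H_v$ is a partial order). For each vertex $u$, $T_u$ is the subtree being processed when $u$ is chosen. Write $u\prec v$ if $u\in H_v$ and $u\ne v$. For each vertex $u$, let $T'$ be a largest connected component of $T_u-u$ (empty if $T_u=\{u\}$) and define $M_u=|T_u|-|T'|$. -}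

module Defs where

open import Data.Nat using (ℕ; _≤_; _≥_; _+_; _∸_)
open import Data.Fin using (Fin)
open import Data.Fin.Subset using (Subset; _∈_; _-_; ∣_∣; ⊤)
open import Data.List using (List; []; _∷_; length; map; allFin)
open import Data.Nat.ListAction using (sum)
open import Data.List.Relation.Unary.Unique.Propositional using (Unique)
import Data.List.Membership.Propositional as LM
open import Data.Product using (Σ; ∃; _×_; _,_)
open import Data.Sum using (_⊎_)
open import Relation.Nullary using (¬_)
open import Relation.Binary.PropositionalEquality using (_≡_)

record Graph (n : ℕ) : Set₁ where
  field
    Adj   : Fin n → Fin n → Set
    sym   : ∀ {u v} → Adj u v → Adj v u
    irrefl : ∀ {u} → ¬ Adj u u
open Graph public

module _ {n : ℕ} (G : Graph n) where

  data WalkIn (S : Subset n) : Fin n → Fin n → List (Fin n) → Set where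
    stop : ∀ {u} → u ∈ S → WalkIn S u u (u ∷ [])
    step : ∀ {u w v xs} → u ∈ S → Adj G u w → WalkIn S w v xs →
           WalkIn S u v (u ∷ xs)

  PathIn : Subset n → Fin n → Fin n → List (Fin n) → Set
  PathIn S u v xs = WalkIn S u v xs × Unique xs

  ConnIn : Subset n → Fin n → Fin n → Set
  ConnIn S u v = ∃ λ xs → WalkIn S u v xs

  -- Trees: connected and acyclic (no cycle of length ≥ 3).
  record IsTree : Set where
    field
      connected : ∀ u v → ConnIn ⊤ u v
      acyclic   : ∀ u v xs → PathIn ⊤ u v xs → 3 ≤ length xs → ¬ Adj G v u

  -- w lies on the u–v path P_uv (the unique simple u–v path in a tree).
  OnPath : Fin n → Fin n → Fin n → Set
  OnPath u v w = ∃ λ xs → PathIn ⊤ u v xs × w LM.∈ xs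

  IsHubLabeling : (Fin n → Subset n) → Set
  IsHubLabeling H = ∀ u v → ∃ λ w → w ∈ H u × w ∈ H v × OnPath u v w

  cost : (Fin n → Subset n) → ℕ
  cost H = sum (map (λ u → ∣ H u ∣) (allFin n))

  HL₁-optimal : (Fin n → Subset n) → Set
  HL₁-optimal H = IsHubLabeling H × (∀ H' → IsHubLabeling H' → cost H ≤ cost H')

  IsComponent : Subset n → Subset n → Set
  IsComponent C S =
    (∃ λ c → c ∈ C) ×
    (∀ x → x ∈ C → x ∈ S) ×
    (∀ x y → x ∈ C → y ∈ S → (y ∈ C → ConnIn S x y) × (ConnIn S x y → y ∈ C))

  data Decomposition : Subset n → Set where
    node : ∀ {S} (r : Fin n) → r ∈ S →
           ((C : Subset n) → IsComponent C (S - r) → Decomposition C) →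
           Decomposition S

  -- Hub u d v : u ∈ H_v in the labeling built by decomposition d.
  data Hub : ∀ {S} → Decomposition S → Fin n → Fin n → Set where
    here  : ∀ {S r p sub v} → v ∈ S → Hub (node {S} r p sub) r v
    there : ∀ {S r p sub u v} C (c : IsComponent C (S - r)) →
            Hub (sub C c) u v → Hub (node {S} r p sub) u v

  -- Chosen d u Tu : u is chosen while processing the subtree Tu (i.e. Tu = T_u).
  data Chosen : ∀ {S} → Decomposition S → Fin n → Subset n → Set where
    here  : ∀ {S r p sub} → Chosen (node {S} r p sub) r S
    there : ∀ {S r p sub u S'} C (c : IsComponent C (S - r)) →
            Chosen (sub C c) u S' → Chosen (node {S} r p sub) u S'

  Produces : ∀ {S} → Decomposition S → (Fin n → Subset n) → Set
  Produces d H = ∀ u v → (u ∈ H v → Hub d u v) × (Hub d u v → u ∈ H v)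

  LargestComp : Subset n → Fin n → ℕ → Set
  LargestComp S u k =
    (∃ λ C → IsComponent C (S - u) × ∣ C ∣ ≡ k ×
             (∀ C' → IsComponent C' (S - u) → ∣ C' ∣ ≤ k))
    ⊎ ((∀ C → ¬ IsComponent C (S - u)) × k ≡ 0)

  -- M_u = |T_u| - |T'|, given T_u and the largest component size k.
  M : Subset n → ℕ → ℕ
  M Tu k = ∣ Tu ∣ ∸ k

-- Along the decomposition, the label of a vertex x contains only x and the vertices chosen above
-- it: otherwise deleting the extra hubs would lower the cost.  The core is an exchange argument.
-- Let r be chosen for the subtree S, let C be a component of S - r whose first chosen vertex is r′,
-- and let X be the component of C - r′ adjacent to r.  Letting the vertices of C outside X use r′
-- instead of r, and adding r′ to the labels of S outside C, gives another hub labeling, so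
-- optimality yields 2∣C∣ ≤ ∣S∣ + ∣X∣.  Descending the decomposition this becomes M_v + ∣C∣ ≤ ∣S∣
-- for every v chosen inside C; for S = T_u, comparing C with a largest component of T_u - u
-- gives M_v ≤ M_u.

module Submission where

open import Defs
open import Data.Nat using (ℕ; _≤_)
open import Data.Fin using (Fin)
open import Data.Fin.Subset using (Subset; _∈_; ⊤)
open import Relation.Binary.PropositionalEquality using (_≢_)

open import Data.Nat using (zero; suc; _+_; _<_; _∸_; z≤n; s≤s)
import Data.Nat.Properties as ℕ
open import Algebra.Properties.CommutativeSemigroup ℕ.+-commutativeSemigroup
  using (interchange; xy∙z≈xz∙y)
open import Data.Fin using (zero; suc; _≟_)
open import Data.Fin.Subset using (_∉_; _⊆_; _-_; _─_; _∪_; _∩_; ⁅_⁆; ∣_∣; inside; outside)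
  renaming (⊥ to ∅)
import Data.Fin.Subset.Properties as Subset
open import Data.Vec.Base using ([]; _∷_; here; there)
import Data.Vec.Base as Vec
import Data.Vec.Properties as Vec
open import Data.Bool using (if_then_else_)
open import Data.List using (List; []; _∷_; _++_; _∷ʳ_; reverse; length; tabulate)
open import Data.Nat.ListAction using (sum)
open import Function using (_∘_)
import Data.List.Properties as List
open import Data.List.Membership.Propositional using () renaming (_∈_ to _∈ₗ_; _∉_ to _∉ₗ_)
open import Data.List.Membership.Propositional.Properties using (∈-++⁺ˡ)
open import Data.List.Relation.Unary.Any using (here; there; any?)
import Data.List.Relation.Unary.Any.Properties as Any
open import Data.List.Relation.Unary.All as All using (All; []; _∷_)
import Data.List.Relation.Unary.All.Properties as All
open import Data.List.Relation.Unary.AllPairs using ([]; _∷_)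
open import Data.List.Relation.Unary.Unique.Propositional using (Unique)
open import Data.List.Relation.Unary.Unique.Propositional.Properties
  using () renaming (++⁺ to Unique-++⁺)
open import Data.List.Relation.Binary.Permutation.Propositional using (↭⇒↭ₛ; ↭-sym)
open import Data.List.Relation.Binary.Permutation.Propositional.Properties using (↭-reverse)
import Data.List.Relation.Binary.Permutation.Setoid.Properties as Permutationₛ
open import Data.Product using (∃; ∃₂; _×_; _,_; proj₁; proj₂)
open import Data.Sum using (_⊎_; inj₁; inj₂; [_,_]′)
open import Data.Empty using (⊥; ⊥-elim)
open import Relation.Nullary using (¬_; Dec; yes; no; does)
open import Relation.Nullary.Decidable using (_×-dec_)
open import Relation.Binary.PropositionalEquality
  using (_≡_; refl; cong; subst; subst₂; trans; setoid) renaming (sym to ≡-sym)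

x∈p─q⇒x∉q : ∀ {n} {p q : Subset n} {x} → x ∈ p ─ q → x ∉ q
x∈p─q⇒x∉q {p = _ ∷ p} {inside ∷ q}  (there x∈) (there x∈q) = x∈p─q⇒x∉q x∈ x∈q
x∈p─q⇒x∉q {p = _ ∷ p} {outside ∷ q} (there x∈) (there x∈q) = x∈p─q⇒x∉q x∈ x∈q

x∈p-y⇒x≢y : ∀ {n} {p : Subset n} {x y} → x ∈ p - y → x ≢ y
x∈p-y⇒x≢y x∈ refl = x∈p─q⇒x∉q x∈ (Subset.x∈⁅x⁆ _)

x∈p-y⇒x∈p : ∀ {n} {p : Subset n} {x y} → x ∈ p - y → x ∈ p
x∈p-y⇒x∈p = Subset.p─q⊆p _ _

∈-∪⁅⁆⁻ : ∀ {n} {A : Subset n} {r y} → y ∈ A ∪ ⁅ r ⁆ → y ∈ A ⊎ y ≡ r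
∈-∪⁅⁆⁻ {A = A} {r} y∈ with Subset.x∈p∪q⁻ A ⁅ r ⁆ y∈
... | inj₁ y∈A = inj₁ y∈A
... | inj₂ y∈r = inj₂ (Subset.x∈⁅y⁆⇒x≡y r y∈r)

∉-∪⁅⁆ : ∀ {n} {A : Subset n} {r y} → y ∉ A → y ≢ r → y ∉ A ∪ ⁅ r ⁆
∉-∪⁅⁆ y∉A y≢r y∈ = [ y∉A , y≢r ]′ (∈-∪⁅⁆⁻ y∈)

All-∈-⁺ : ∀ {n} {S : Subset n} {r xs} → All (_∈ S) xs → All (r ≢_) xs → All (_∈ S - r) xs
All-∈-⁺ xs⊆S r∉xs = All.zipWith (λ (y∈S , r≢y) → Subset.x∈p∧x≢y⇒x∈p-y y∈S (r≢y ∘ ≡-sym)) (xs⊆S , r∉xs)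

module _ {n : ℕ} {P : Fin n → Set} where

  subsetOf : (∀ x → Dec (P x)) → Subset n
  subsetOf P? = Vec.tabulate (λ x → if does (P? x) then inside else outside)

  ∈subsetOf⁺ : ∀ (P? : ∀ x → Dec (P x)) {x} → P x → x ∈ subsetOf P?
  ∈subsetOf⁺ P? {x} px = Vec.lookup⇒[]= x _ (trans (Vec.lookup∘tabulate _ x) (decided (P? x)))
    where
    decided : (d : Dec (P x)) → (if does d then inside else outside) ≡ inside
    decided (yes _)  = refl
    decided (no ¬px) = ⊥-elim (¬px px)

  ∈subsetOf⁻ : ∀ (P? : ∀ x → Dec (P x)) {x} → x ∈ subsetOf P? → P x
  ∈subsetOf⁻ P? {x} x∈ = decided (P? x) (trans (≡-sym (Vec.lookup∘tabulate _ x)) (Vec.[]=⇒lookup x∈))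
    where
    decided : (d : Dec (P x)) → (if does d then inside else outside) ≡ inside → P x
    decided (yes px) _ = px

∣p∪q∣≤∣p∣+∣q∣ : ∀ {n} (p q : Subset n) → ∣ p ∪ q ∣ ≤ ∣ p ∣ + ∣ q ∣
∣p∪q∣≤∣p∣+∣q∣ []            []            = z≤n
∣p∪q∣≤∣p∣+∣q∣ (inside  ∷ p) (inside  ∷ q) =
  s≤s (ℕ.≤-trans (∣p∪q∣≤∣p∣+∣q∣ p q) (ℕ.+-monoʳ-≤ ∣ p ∣ (ℕ.n≤1+n _)))
∣p∪q∣≤∣p∣+∣q∣ (inside  ∷ p) (outside ∷ q) = s≤s (∣p∪q∣≤∣p∣+∣q∣ p q)
∣p∪q∣≤∣p∣+∣q∣ (outside ∷ p) (inside  ∷ q) =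
  ℕ.≤-trans (s≤s (∣p∪q∣≤∣p∣+∣q∣ p q)) (ℕ.≤-reflexive (≡-sym (ℕ.+-suc ∣ p ∣ ∣ q ∣)))
∣p∪q∣≤∣p∣+∣q∣ (outside ∷ p) (outside ∷ q) = ∣p∪q∣≤∣p∣+∣q∣ p q

disjoint⇒∣p∣+∣q∣≤∣p∪q∣ : ∀ {n} (p q : Subset n) → (∀ {x} → x ∈ p → x ∉ q) → ∣ p ∣ + ∣ q ∣ ≤ ∣ p ∪ q ∣
disjoint⇒∣p∣+∣q∣≤∣p∪q∣ []            []            _ = z≤n
disjoint⇒∣p∣+∣q∣≤∣p∪q∣ (inside  ∷ p) (inside  ∷ q) p#q = ⊥-elim (p#q here here)
disjoint⇒∣p∣+∣q∣≤∣p∪q∣ (inside  ∷ p) (outside ∷ q) p#q =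
  s≤s (disjoint⇒∣p∣+∣q∣≤∣p∪q∣ p q λ x∈p x∈q → p#q (there x∈p) (there x∈q))
disjoint⇒∣p∣+∣q∣≤∣p∪q∣ (outside ∷ p) (inside  ∷ q) p#q =
  ℕ.≤-trans (ℕ.≤-reflexive (ℕ.+-suc ∣ p ∣ ∣ q ∣))
            (s≤s (disjoint⇒∣p∣+∣q∣≤∣p∪q∣ p q λ x∈p x∈q → p#q (there x∈p) (there x∈q)))
disjoint⇒∣p∣+∣q∣≤∣p∪q∣ (outside ∷ p) (outside ∷ q) p#q =
  disjoint⇒∣p∣+∣q∣≤∣p∪q∣ p q λ x∈p x∈q → p#q (there x∈p) (there x∈q)

disjoint⇒∣p∣+∣q∣≤∣s∣ : ∀ {n} {p q s : Subset n} → p ⊆ s → q ⊆ s → (∀ {x} → x ∈ p → x ∉ q) →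
                      ∣ p ∣ + ∣ q ∣ ≤ ∣ s ∣
disjoint⇒∣p∣+∣q∣≤∣s∣ {p = p} {q} p⊆s q⊆s p#q =
  ℕ.≤-trans (disjoint⇒∣p∣+∣q∣≤∣p∪q∣ p q p#q)
            (Subset.p⊆q⇒∣p∣≤∣q∣ λ x∈ → [ p⊆s , q⊆s ]′ (Subset.x∈p∪q⁻ p q x∈))

∣p∣≤∣p─q∣+∣q∣ : ∀ {n} (p q : Subset n) → ∣ p ∣ ≤ ∣ p ─ q ∣ + ∣ q ∣
∣p∣≤∣p─q∣+∣q∣ p q = ℕ.≤-trans (Subset.p⊆q⇒∣p∣≤∣q∣ p⊆p─q∪q) (∣p∪q∣≤∣p∣+∣q∣ (p ─ q) q)
  where
  p⊆p─q∪q : p ⊆ (p ─ q) ∪ q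
  p⊆p─q∪q {x} x∈p with x Subset.∈? q
  ... | yes x∈q = Subset.x∈p∪q⁺ (inj₂ x∈q)
  ... | no  x∉q = Subset.x∈p∪q⁺ (inj₁ (Subset.x∈p∧x∉q⇒x∈p─q x∈p x∉q))

m+o≤n⇒n+n≤p+o⇒m+n≤p : ∀ {m n o p} → m + o ≤ n → n + n ≤ p + o → m + n ≤ p
m+o≤n⇒n+n≤p+o⇒m+n≤p {m} {n} {o} {p} m+o≤n n+n≤p+o = ℕ.+-cancelʳ-≤ o (m + n) p (begin
  m + n + o   ≡⟨ xy∙z≈xz∙y m n o ⟩
  m + o + n   ≤⟨ ℕ.+-monoˡ-≤ n m+o≤n ⟩
  n + n       ≤⟨ n+n≤p+o ⟩
  p + o       ∎)
  where open ℕ.≤-Reasoning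

m∸n+o≤m : ∀ {m n o} → o ≤ n → o ≤ m → m ∸ n + o ≤ m
m∸n+o≤m {m} {n} {o} o≤n o≤m =
  ℕ.≤-trans (ℕ.+-monoˡ-≤ o (ℕ.∸-monoʳ-≤ m o≤n)) (ℕ.≤-reflexive (ℕ.m∸n+n≡m o≤m))

ind : ∀ {A : Set} → Dec A → ℕ
ind d = if does d then 1 else 0

∑ : ∀ {n} → (Fin n → ℕ) → ℕ
∑ f = sum (tabulate f)

∑-mono-≤ : ∀ {n} {f g : Fin n → ℕ} → (∀ x → f x ≤ g x) → ∑ f ≤ ∑ g
∑-mono-≤ {zero}  _   = z≤n
∑-mono-≤ {suc n} f≤g = ℕ.+-mono-≤ (f≤g zero) (∑-mono-≤ (f≤g ∘ suc))

∑-mono-< : ∀ {n} {f g : Fin n → ℕ} → (∀ x → f x ≤ g x) → ∀ y → f y < g y → ∑ f < ∑ g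
∑-mono-< {suc n} f≤g zero    fy<gy = ℕ.+-mono-<-≤ fy<gy (∑-mono-≤ (f≤g ∘ suc))
∑-mono-< {suc n} f≤g (suc y) fy<gy = ℕ.+-mono-≤-< (f≤g zero) (∑-mono-< (f≤g ∘ suc) y fy<gy)

∑-distrib-+ : ∀ {n} (f g : Fin n → ℕ) → ∑ (λ x → f x + g x) ≡ ∑ f + ∑ g
∑-distrib-+ {zero}  f g = refl
∑-distrib-+ {suc n} f g = trans (cong (f zero + g zero +_) (∑-distrib-+ (f ∘ suc) (g ∘ suc)))
                                (interchange (f zero) (g zero) (∑ (f ∘ suc)) (∑ (g ∘ suc)))

∑-ind : ∀ {n} (p : Subset n) → ∑ (λ x → ind (x Subset.∈? p)) ≡ ∣ p ∣
∑-ind []            = refl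
∑-ind (inside  ∷ p) = cong suc (∑-ind p)
∑-ind (outside ∷ p) = ∑-ind p

module _ {A : Set} where

  Unique-++⁻ˡ : ∀ xs {ys : List A} → Unique (xs ++ ys) → Unique xs
  Unique-++⁻ˡ []       _          = []
  Unique-++⁻ˡ (x ∷ xs) (x∉ ∷ xs!) = All.++⁻ˡ xs x∉ ∷ Unique-++⁻ˡ xs xs!

  Unique-++⁻ʳ : ∀ xs {ys : List A} → Unique (xs ++ ys) → Unique ys
  Unique-++⁻ʳ []       ys!       = ys!
  Unique-++⁻ʳ (x ∷ xs) (_ ∷ xs!) = Unique-++⁻ʳ xs xs!

  Unique-reverse⁺ : ∀ {xs : List A} → Unique xs → Unique (reverse xs)
  Unique-reverse⁺ {xs} =
    Permutationₛ.Unique-resp-↭ (setoid A) (↭⇒↭ₛ (↭-sym (↭-reverse xs)))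

module Walks {n : ℕ} (G : Graph n) where

  head∈ : ∀ {S a b xs} → WalkIn G S a b xs → a ∈ₗ xs
  head∈ (stop _)     = here refl
  head∈ (step _ _ _) = here refl

  last∈ : ∀ {S a b xs} → WalkIn G S a b xs → b ∈ₗ xs
  last∈ (stop _)     = here refl
  last∈ (step _ _ w) = there (last∈ w)

  walk⊆ : ∀ {S a b xs} → WalkIn G S a b xs → All (_∈ S) xs
  walk⊆ (stop a∈S)     = a∈S ∷ []
  walk⊆ (step a∈S _ w) = a∈S ∷ walk⊆ w

  restrict : ∀ {S S′ a b xs} → WalkIn G S′ a b xs → All (_∈ S) xs → WalkIn G S a b xs
  restrict (stop _)     (a∈S ∷ [])   = stop a∈S
  restrict (step _ e w) (a∈S ∷ xs⊆S) = step a∈S e (restrict w xs⊆S)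

  weaken : ∀ {S a b xs} → WalkIn G S a b xs → WalkIn G ⊤ a b xs
  weaken w = restrict w (All.universal (λ _ → Subset.∈⊤) _)

  append : ∀ {S a b c xs ys} → WalkIn G S a b xs → WalkIn G S b c ys → ConnIn G S a c
  append (stop _)       w′ = _ , w′
  append (step a∈S e w) w′ = _ , step a∈S e (proj₂ (append w w′))

  snoc : ∀ {S a b c xs} → WalkIn G S a b xs → Adj G b c → c ∈ S → WalkIn G S a c (xs ∷ʳ c)
  snoc (stop a∈S)     e c∈S = step a∈S e (stop c∈S)
  snoc (step a∈S e w) f c∈S = step a∈S e (snoc w f c∈S)

  reverseʷ : ∀ {S a b xs} → WalkIn G S a b xs → WalkIn G S b a (reverse xs)
  reverseʷ (stop a∈S) = stop a∈S
  reverseʷ {S} (step {a} {_} {b} {xs} a∈S e w) =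
    subst (WalkIn G S b a) (≡-sym (List.unfold-reverse a xs)) (snoc (reverseʷ w) (sym G e) a∈S)

  prefixTo : ∀ {S a b y xs} → WalkIn G S a b xs → y ∈ₗ xs →
             ∃₂ λ pre rest → xs ≡ pre ++ rest × WalkIn G S a y pre
  prefixTo (stop a∈S)               (here refl) = _ , [] , refl , stop a∈S
  prefixTo (step {xs = xs} a∈S _ _) (here refl) = _ ∷ [] , xs , refl , stop a∈S
  prefixTo (step a∈S e w)           (there y∈)  with prefixTo w y∈
  ... | pre , rest , refl , w′ = _ ∷ pre , rest , refl , step a∈S e w′

  suffixFrom : ∀ {S a b y xs} → WalkIn G S a b xs → y ∈ₗ xs →
               ∃₂ λ pre ys → xs ≡ pre ++ ys × WalkIn G S y b ys
  suffixFrom w@(stop _)     (here refl) = [] , _ , refl , w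
  suffixFrom w@(step _ _ _) (here refl) = [] , _ , refl , w
  suffixFrom (step _ _ w)   (there y∈)  with suffixFrom w y∈
  ... | pre , ys , refl , w′ = _ ∷ pre , ys , refl , w′

  shortcut : ∀ {S a b xs} → WalkIn G S a b xs → ∃ λ ys → PathIn G S a b ys
  shortcut (stop a∈S) = _ , stop a∈S , [] ∷ []
  shortcut (step {a} a∈S e w) with shortcut w
  ... | ys , w′ , ys! with any? (a ≟_) ys
  ...   | no a∉ys = a ∷ ys , step a∈S e w′ , All.¬Any⇒All¬ ys a∉ys ∷ ys!
  ...   | yes a∈ys with suffixFrom w′ a∈ys
  ...     | pre , zs , refl , w″ = zs , w″ , Unique-++⁻ʳ pre ys!

module TreePaths {n : ℕ} (G : Graph n) (tree : IsTree G) where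
  open Walks G public
  open IsTree tree

  private
    avoiding : ∀ {a b c xs} → WalkIn G ⊤ b c xs → All (a ≢_) xs → WalkIn G (⊤ - a) b c xs
    avoiding w a∉xs = restrict w (All-∈-⁺ (All.universal (λ _ → Subset.∈⊤) _) a∉xs)

    2≤length : ∀ {S p q zs} → p ≢ q → WalkIn G S p q zs → 2 ≤ length zs
    2≤length p≢q (stop _)                = ⊥-elim (p≢q refl)
    2≤length _   (step _ _ (stop _))     = s≤s (s≤s z≤n)
    2≤length _   (step _ _ (step _ _ _)) = s≤s (s≤s z≤n)

    -- Joining p ⇝ b ⇝ q outside a would close the cycle a p ⋯ q a.
    no-fork : ∀ {a p q b xs ys} → Adj G a p → Adj G a q → p ≢ q →
              WalkIn G (⊤ - a) p b xs → WalkIn G (⊤ - a) q b ys → ⊥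
    no-fork {a} {q = q} a~p a~q p≢q wp wq with shortcut (proj₂ (append wp (reverseʷ wq)))
    ... | zs , pq , zs! =
      acyclic a q (a ∷ zs)
        (step Subset.∈⊤ a~p (weaken pq) ,
         All.map (λ z∈ a≡z → x∈p-y⇒x≢y z∈ (≡-sym a≡z)) (walk⊆ pq) ∷ zs!)
        (s≤s (2≤length p≢q pq)) (sym G a~q)

  paths-unique : ∀ {a b xs ys} → PathIn G ⊤ a b xs → PathIn G ⊤ a b ys → xs ≡ ys
  paths-unique (stop _ , _)          (stop _ , _)          = refl
  paths-unique (stop _ , _)          (step _ _ w , a∉ ∷ _) = ⊥-elim (All.lookup a∉ (last∈ w) refl)
  paths-unique (step _ _ w , a∉ ∷ _) (stop _ , _)          = ⊥-elim (All.lookup a∉ (last∈ w) refl)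
  paths-unique (step {w = p} _ a~p wp , a∉xs ∷ xs!) (step {w = q} _ a~q wq , a∉ys ∷ ys!) with p ≟ q
  ... | yes refl = cong (_ ∷_) (paths-unique (wp , xs!) (wq , ys!))
  ... | no p≢q   = ⊥-elim (no-fork a~p a~q p≢q (avoiding wp a∉xs) (avoiding wq a∉ys))

  path : Fin n → Fin n → List (Fin n)
  path a b = proj₁ (shortcut (proj₂ (connected a b)))

  path-isPath : ∀ a b → PathIn G ⊤ a b (path a b)
  path-isPath a b = proj₂ (shortcut (proj₂ (connected a b)))

  path-walk : ∀ a b → WalkIn G ⊤ a b (path a b)
  path-walk a b = proj₁ (path-isPath a b)

  path-canonical : ∀ {S a b xs} → PathIn G S a b xs → xs ≡ path a b
  path-canonical (w , xs!) = paths-unique (weaken w , xs!) (path-isPath _ _)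

  OnPath⇒∈path : ∀ {a b w} → OnPath G a b w → w ∈ₗ path a b
  OnPath⇒∈path (_ , p , w∈) = subst (_ ∈ₗ_) (path-canonical p) w∈

  ∈path⇒OnPath : ∀ {a b w} → w ∈ₗ path a b → OnPath G a b w
  ∈path⇒OnPath w∈ = _ , path-isPath _ _ , w∈

  ∈path-sym : ∀ {a b w} → w ∈ₗ path a b → w ∈ₗ path b a
  ∈path-sym {a} {b} w∈ = subst (_ ∈ₗ_) (path-canonical reversed) (Any.reverse⁺ w∈)
    where
    reversed : PathIn G ⊤ b a (reverse (path a b))
    reversed = reverseʷ (path-walk a b) , Unique-reverse⁺ (proj₂ (path-isPath a b))

  path⊆ : ∀ {S a b} → ConnIn G S a b → All (_∈ S) (path a b)
  path⊆ (_ , w) with shortcut w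
  ... | _ , p = subst (All _) (path-canonical p) (walk⊆ (proj₁ p))

  ∈path-prefix : ∀ {a b w y} → w ∈ₗ path a b → y ∈ₗ path a w → y ∈ₗ path a b
  ∈path-prefix {a} {b} w∈ y∈ with prefixTo (path-walk a b) w∈
  ... | pre , rest , split , to-w = subst (_ ∈ₗ_) (≡-sym split) (∈-++⁺ˡ (subst (_ ∈ₗ_) pre≡path y∈))
    where
    pre≡path : path a _ ≡ pre
    pre≡path =
      ≡-sym (path-canonical (to-w , Unique-++⁻ˡ pre (subst Unique split (proj₂ (path-isPath a b)))))

  path-∷ʳ : ∀ {a x r} → Adj G x r → r ∉ₗ path a x → path a x ∷ʳ r ≡ path a r
  path-∷ʳ {a} {x} x~r r∉ =
    path-canonical (snoc (path-walk a x) x~r Subset.∈⊤ ,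
                    Unique-++⁺ (proj₂ (path-isPath a x)) ([] ∷ []) λ { (r∈ , here refl) → r∉ r∈ })

module Components {n : ℕ} (G : Graph n) (tree : IsTree G) where
  open TreePaths G tree public

  ConnIn-sym : ∀ {S a b} → ConnIn G S a b → ConnIn G S b a
  ConnIn-sym (_ , w) = _ , reverseʷ w

  ConnIn-trans : ∀ {S a b c} → ConnIn G S a b → ConnIn G S b c → ConnIn G S a c
  ConnIn-trans (_ , w) (_ , w′) = append w w′

  ConnIn-path : ∀ {S a b} → ConnIn G S a b → WalkIn G S a b (path a b)
  ConnIn-path c = restrict (path-walk _ _) (path⊆ c)

  Convex : Subset n → Set
  Convex S = ∀ {a b} → a ∈ S → b ∈ S → All (_∈ S) (path a b)

  component⊆ : ∀ {C S} → IsComponent G C S → ∀ {y} → y ∈ C → y ∈ S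
  component⊆ (_ , C⊆S , _) = C⊆S _

  component-convex : ∀ {C S} → IsComponent G C S → Convex C
  component-convex {C} {S} C-comp@(_ , _ , closed) {a} {b} a∈C b∈C =
    All.tabulate λ y∈ → proj₂ (closed a _ a∈C (All.lookup (walk⊆ a⇝b) y∈)) (prefix-conn y∈)
    where
    a⇝b : WalkIn G S a b (path a b)
    a⇝b = ConnIn-path (proj₁ (closed a b a∈C (component⊆ C-comp b∈C)) b∈C)
    prefix-conn : ∀ {y} → y ∈ₗ path a b → ConnIn G S a y
    prefix-conn y∈ with prefixTo a⇝b y∈
    ... | _ , _ , _ , a⇝y = _ , a⇝y

  components-meet⇒⊆ : ∀ {C D S y} → IsComponent G C S → IsComponent G D S →
                      y ∈ C → y ∈ D → ∀ {z} → z ∈ C → z ∈ D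
  components-meet⇒⊆ {y = y} C-comp@(_ , _ , closedC) (_ , _ , closedD) y∈C y∈D {z} z∈C =
    proj₂ (closedD y z y∈D z∈S) (proj₁ (closedC y z y∈C z∈S) z∈C)
    where z∈S = component⊆ C-comp z∈C

  pathWithin? : ∀ S x y → Dec (y ∈ S × All (_∈ S) (path y x))
  pathWithin? S x y = (y Subset.∈? S) ×-dec All.all? (Subset._∈? S) (path y x)

  component⊆parent : ∀ {C S r} → IsComponent G C (S - r) → ∀ {y} → y ∈ C → y ∈ S
  component⊆parent C-comp = x∈p-y⇒x∈p ∘ component⊆ C-comp

  component∌removed : ∀ {C S r} → IsComponent G C (S - r) → r ∉ C
  component∌removed C-comp r∈C = x∈p-y⇒x≢y (component⊆ C-comp r∈C) refl

  leaving-component⇒∈path : ∀ {C S r a b} → IsComponent G C (S - r) → a ∈ C → b ∈ S → b ∉ C →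
                            All (_∈ S) (path a b) → r ∈ₗ path a b
  leaving-component⇒∈path {C} {S} {r} {a} {b} (_ , _ , closed) a∈C b∈S b∉C a⇝b⊆S
    with any? (r ≟_) (path a b)
  ... | yes r∈ = r∈
  ... | no  r∉ = ⊥-elim (b∉C (proj₂ (closed a b a∈C (All.lookup a⇝b⊆S-r (last∈ (path-walk a b))))
                                      (_ , restrict (path-walk a b) a⇝b⊆S-r)))
    where
    a⇝b⊆S-r : All (_∈ S - r) (path a b)
    a⇝b⊆S-r = All-∈-⁺ a⇝b⊆S (All.¬Any⇒All¬ _ r∉)

  componentOf : Subset n → Fin n → Subset n
  componentOf S x = subsetOf (pathWithin? S x)

  componentOf⊆ : ∀ {S x y} → y ∈ componentOf S x → y ∈ S
  componentOf⊆ {S} {x} y∈ = proj₁ (∈subsetOf⁻ (pathWithin? S x) y∈)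

  ∈componentOf⇒ConnIn : ∀ {S x y} → y ∈ componentOf S x → ConnIn G S y x
  ∈componentOf⇒ConnIn {S} {x} y∈ =
    _ , restrict (path-walk _ _) (proj₂ (∈subsetOf⁻ (pathWithin? S x) y∈))

  ConnIn⇒∈componentOf : ∀ {S x y} → y ∈ S → ConnIn G S y x → y ∈ componentOf S x
  ConnIn⇒∈componentOf {S} {x} y∈S y⇝x = ∈subsetOf⁺ (pathWithin? S x) (y∈S , path⊆ y⇝x)

  ∈componentOf-self : ∀ {S x} → x ∈ S → x ∈ componentOf S x
  ∈componentOf-self x∈S = ConnIn⇒∈componentOf x∈S (_ , stop x∈S)

  componentOf-isComponent : ∀ {S x y} → y ∈ componentOf S x → IsComponent G (componentOf S x) S
  componentOf-isComponent {S} {x} y∈ = (_ , y∈) , (λ _ → componentOf⊆) , closed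
    where
    closed : ∀ a b → a ∈ componentOf S x → b ∈ S →
             (b ∈ componentOf S x → ConnIn G S a b) × (ConnIn G S a b → b ∈ componentOf S x)
    closed a b a∈ b∈S =
      (λ b∈ → ConnIn-trans (∈componentOf⇒ConnIn a∈) (ConnIn-sym (∈componentOf⇒ConnIn b∈))) ,
      (λ a⇝b → ConnIn⇒∈componentOf b∈S (ConnIn-trans (ConnIn-sym a⇝b) (∈componentOf⇒ConnIn a∈)))

  component-neighbour : ∀ {S C r r′} → IsComponent G C (S - r) → All (_∈ S) (path r r′) → r′ ∈ C →
                        ∃ λ x → x ∈ C × Adj G x r
  component-neighbour {S} {C} {r} {r′} (_ , C⊆ , closed) r⇝r′⊆S r′∈C = go (path-isPath r r′) r⇝r′⊆S
    where
    go : ∀ {xs} → PathIn G ⊤ r r′ xs → All (_∈ S) xs → ∃ λ x → x ∈ C × Adj G x r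
    go (stop _ , _) _ = ⊥-elim (x∈p-y⇒x≢y (C⊆ _ r′∈C) refl)
    go (step {w = x} {xs = ys} _ r~x x⇝r′ , r∉ ∷ _) (_ ∷ ⊆S) =
      x , proj₂ (closed r′ x r′∈C (All.lookup ⊆S-r (head∈ x⇝r′)))
                (ConnIn-sym (_ , restrict x⇝r′ ⊆S-r)) , sym G r~x
      where
      ⊆S-r : All (_∈ S - r) ys
      ⊆S-r = All-∈-⁺ ⊆S r∉

module Decompositions {n : ℕ} (G : Graph n) (tree : IsTree G) where
  open Components G tree

  chosen⊆ : ∀ {S} {Dₛ : Decomposition G S} {w T} → Chosen G Dₛ w T → w ∈ T × T ⊆ S
  chosen⊆ (here {p = w∈S})    = w∈S , (λ y∈ → y∈)
  chosen⊆ (there C C-comp ch) with chosen⊆ ch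
  ... | w∈T , T⊆C = w∈T , component⊆parent C-comp ∘ T⊆C

  chosen⇒hub : ∀ {S} {Dₛ : Decomposition G S} {w T y} → Chosen G Dₛ w T → y ∈ T → Hub G Dₛ w y
  chosen⇒hub here                y∈T = here y∈T
  chosen⇒hub (there C C-comp ch) y∈T = there C C-comp (chosen⇒hub ch y∈T)

  chosen-exists : ∀ {S} (Dₛ : Decomposition G S) {x} → x ∈ S → ∃ λ T → Chosen G Dₛ x T
  chosen-exists {S} (node r _ sub) {x} x∈S with x ≟ r
  ... | yes refl = S , here
  ... | no  x≢r  = let x∈C    = ∈componentOf-self (Subset.x∈p∧x≢y⇒x∈p-y x∈S x≢r)
                       C-comp = componentOf-isComponent x∈C
                   in Data.Product.map₂ (there _ C-comp) (chosen-exists (sub _ C-comp) x∈C)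

  M≤∣S∣ : ∀ {S} {Dₛ : Decomposition G S} {v T k} → Chosen G Dₛ v T → M G T k ≤ ∣ S ∣
  M≤∣S∣ {T = T} {k} ch = ℕ.≤-trans (ℕ.m∸n≤m ∣ T ∣ k) (Subset.p⊆q⇒∣p∣≤∣q∣ (chosen⊆ ch .proj₂))

  largest-bound : ∀ {T v k X} → LargestComp G T v k → IsComponent G X (T - v) → ∣ X ∣ ≤ k
  largest-bound (inj₁ (_ , _ , _ , maximal)) X-comp = maximal _ X-comp
  largest-bound (inj₂ (none , _))            X-comp = ⊥-elim (none _ X-comp)

module Optimality {n : ℕ} (G : Graph n) {H : Fin n → Subset n} (optimal : HL₁-optimal G H) where

  cost≡∑ : ∀ H′ → cost G H′ ≡ ∑ (λ u → ∣ H′ u ∣)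
  cost≡∑ H′ = cong sum (List.map-tabulate (λ u → u) (λ u → ∣ H′ u ∣))

  private
    ∑H≤∑H′ : ∀ {H′} → IsHubLabeling G H′ → ∑ (λ u → ∣ H u ∣) ≤ ∑ (λ u → ∣ H′ u ∣)
    ∑H≤∑H′ {H′} H′-hub = subst₂ _≤_ (cost≡∑ H) (cost≡∑ H′) (proj₂ optimal H′ H′-hub)

  no-shrinking : ∀ {H′} → IsHubLabeling G H′ → (∀ w → ∣ H′ w ∣ ≤ ∣ H w ∣) → ∀ x → ¬ ∣ H′ x ∣ < ∣ H x ∣
  no-shrinking H′-hub H′≤H x H′x<Hx = ℕ.<⇒≱ (∑-mono-< H′≤H x H′x<Hx) (∑H≤∑H′ H′-hub)

  exchange-bound : ∀ {H′} → IsHubLabeling G H′ → (f g : Fin n → ℕ) →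
                   (∀ w → ∣ H′ w ∣ + f w ≤ ∣ H w ∣ + g w) → ∑ f ≤ ∑ g
  exchange-bound {H′} H′-hub f g pointwise = ℕ.+-cancelˡ-≤ (∑ ∣H′∣) (∑ f) (∑ g) (begin
    ∑ ∣H′∣ + ∑ f                 ≡⟨ ∑-distrib-+ ∣H′∣ f ⟨
    ∑ (λ w → ∣ H′ w ∣ + f w)     ≤⟨ ∑-mono-≤ pointwise ⟩
    ∑ (λ w → ∣ H w ∣ + g w)      ≡⟨ ∑-distrib-+ (λ w → ∣ H w ∣) g ⟩
    ∑ (λ w → ∣ H w ∣) + ∑ g      ≤⟨ ℕ.+-monoˡ-≤ (∑ g) (∑H≤∑H′ H′-hub) ⟩
    ∑ ∣H′∣ + ∑ g                 ∎)
    where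
    open ℕ.≤-Reasoning
    ∣H′∣ : Fin n → ℕ
    ∣H′∣ w = ∣ H′ w ∣

module OptimalDecomposition {n : ℕ} (G : Graph n) (tree : IsTree G) (H : Fin n → Subset n)
                            (d : Decomposition G ⊤) (produces : Produces G d H)
                            (optimal : HL₁-optimal G H) where
  open Components G tree
  open Optimality G optimal
  open Decompositions G tree

  -- Invariant along a branch of d: Dₛ is the part of d processing S, and Anc is the set of
  -- vertices chosen above S.
  record Descent {S : Subset n} (Anc : Subset n) (Dₛ : Decomposition G S) : Set where
    field
      hub⇒∈H        : ∀ {y w} → Hub G Dₛ y w → y ∈ H w
      chosen⇒chosen : ∀ {w T} → Chosen G Dₛ w T → Chosen G d w T
      convex        : Convex S
      separated     : ∀ {a b} → a ∈ S → b ∉ S →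
                      ∃ λ h → h ∈ Anc × h ∈ H a × h ∈ H b × h ∈ₗ path a b × h ∉ S
  open Descent

  Descent-root : Descent ∅ d
  Descent-root = record
    { hub⇒∈H        = λ {y} {w} → proj₂ (produces y w)
    ; chosen⇒chosen = λ ch → ch
    ; convex        = λ _ _ → All.universal (λ _ → Subset.∈⊤) _
    ; separated     = λ _ b∉⊤ → ⊥-elim (b∉⊤ Subset.∈⊤)
    }

  Descent-child : ∀ {S Anc r r∈S sub} → Descent Anc (node {S = S} r r∈S sub) →
                  ∀ {C} (C-comp : IsComponent G C (S - r)) → Descent (Anc ∪ ⁅ r ⁆) (sub C C-comp)
  Descent-child {S} {Anc} {r} desc {C} C-comp = record
    { hub⇒∈H        = λ h → hub⇒∈H desc (there C C-comp h)
    ; chosen⇒chosen = λ ch → chosen⇒chosen desc (there C C-comp ch)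
    ; convex        = component-convex C-comp
    ; separated     = separated′
    }
    where
    C⊆S : ∀ {y} → y ∈ C → y ∈ S
    C⊆S = component⊆parent C-comp
    separated′ : ∀ {a b} → a ∈ C → b ∉ C →
                 ∃ λ h → h ∈ Anc ∪ ⁅ r ⁆ × h ∈ H a × h ∈ H b × h ∈ₗ path a b × h ∉ C
    separated′ {a} {b} a∈C b∉C with b Subset.∈? S
    ... | yes b∈S = r , Subset.x∈p∪q⁺ (inj₂ (Subset.x∈⁅x⁆ r)) ,
                    hub⇒∈H desc (here (C⊆S a∈C)) , hub⇒∈H desc (here b∈S) ,
                    leaving-component⇒∈path C-comp a∈C b∈S b∉C (convex desc (C⊆S a∈C) b∈S) ,
                    component∌removed C-comp
    ... | no  b∉S with separated desc (C⊆S a∈C) b∉S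
    ...   | h , h∈Anc , h∈Ha , h∈Hb , h∈path , h∉S =
            h , Subset.x∈p∪q⁺ (inj₁ h∈Anc) , h∈Ha , h∈Hb , h∈path , h∉S ∘ C⊆S

  root-meets-ancestors : ∀ {S Anc x x∈S sub} → Descent Anc (node {S = S} x x∈S sub) →
                         ∀ b → ∃ λ h → h ∈ Anc ∪ ⁅ x ⁆ × h ∈ H x × h ∈ H b × h ∈ₗ path x b
  root-meets-ancestors {S} {x = x} {x∈S} desc b with b Subset.∈? S
  ... | yes b∈S = x , Subset.x∈p∪q⁺ (inj₂ (Subset.x∈⁅x⁆ x)) ,
                  hub⇒∈H desc (here x∈S) , hub⇒∈H desc (here b∈S) , head∈ (path-walk x b)
  ... | no  b∉S with separated desc x∈S b∉S
  ...   | h , h∈Anc , h∈Hx , h∈Hb , h∈path , _ = h , Subset.x∈p∪q⁺ (inj₁ h∈Anc) , h∈Hx , h∈Hb , h∈path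

  -- Optimality forbids any further hubs: dropping them from H x would keep a hub labeling.
  root-hubs : ∀ {S Anc x x∈S sub} → Descent Anc (node {S = S} x x∈S sub) →
              ∀ {y} → y ∈ H x → y ∈ Anc ∪ ⁅ x ⁆
  root-hubs {S} {Anc} {x} {x∈S} desc {y} y∈Hx with y Subset.∈? (Anc ∪ ⁅ x ⁆)
  ... | yes y∈B = y∈B
  ... | no  y∉B = ⊥-elim (no-shrinking H′-hub H′≤H x (Hx-shrinks (x ≟ x)))
    where
    B : Subset n
    B = Anc ∪ ⁅ x ⁆
    row : ∀ w → Dec (w ≡ x) → Subset n
    row w (yes _) = H w ∩ B
    row w (no _)  = H w
    H′ : Fin n → Subset n
    H′ w = row w (w ≟ x)
    ∈row : ∀ {w h} (w≟x : Dec (w ≡ x)) → h ∈ H w → (w ≡ x → h ∈ B) → h ∈ row w w≟x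
    ∈row (yes w≡x) h∈Hw h∈B = Subset.x∈p∩q⁺ (h∈Hw , h∈B w≡x)
    ∈row (no _)    h∈Hw _   = h∈Hw
    H′-hub : IsHubLabeling G H′
    H′-hub a b = by-cases (a ≟ x) (b ≟ x)
      where
      by-cases : Dec (a ≡ x) → Dec (b ≡ x) → ∃ λ h → h ∈ H′ a × h ∈ H′ b × OnPath G a b h
      by-cases (yes refl) _ with root-meets-ancestors desc b
      ... | h , h∈B , h∈Hx , h∈Hb , h∈path =
            h , ∈row (x ≟ x) h∈Hx (λ _ → h∈B) , ∈row (b ≟ x) h∈Hb (λ _ → h∈B) , ∈path⇒OnPath h∈path
      by-cases (no _) (yes refl) with root-meets-ancestors desc a
      ... | h , h∈B , h∈Hx , h∈Ha , h∈path =
            h , ∈row (a ≟ x) h∈Ha (λ _ → h∈B) , ∈row (x ≟ x) h∈Hx (λ _ → h∈B) ,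
            ∈path⇒OnPath (∈path-sym h∈path)
      by-cases (no a≢x) (no b≢x) with proj₁ optimal a b
      ... | h , h∈Ha , h∈Hb , on-path =
            h , ∈row (a ≟ x) h∈Ha (⊥-elim ∘ a≢x) , ∈row (b ≟ x) h∈Hb (⊥-elim ∘ b≢x) , on-path
    H′≤H : ∀ w → ∣ H′ w ∣ ≤ ∣ H w ∣
    H′≤H w with w ≟ x
    ... | yes _ = Subset.∣p∩q∣≤∣p∣ (H w) B
    ... | no _  = ℕ.≤-refl
    Hx-shrinks : (x≟x : Dec (x ≡ x)) → ∣ row x x≟x ∣ < ∣ H x ∣
    Hx-shrinks (yes _)   = Subset.p⊂q⇒∣p∣<∣q∣
      (Subset.p∩q⊆p (H x) B , y , y∈Hx , y∉B ∘ Subset.p∩q⊆q (H x) B)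
    Hx-shrinks (no x≢x) = ⊥-elim (x≢x refl)

  hub-of-chosen : ∀ {S Anc} {Dₛ : Decomposition G S} {x T} → Descent Anc Dₛ → Chosen G Dₛ x T →
                  ∀ {y} → y ∈ H x → y ∈ Anc ⊎ y ∈ S
  hub-of-chosen desc (here {p = x∈S}) y∈Hx with ∈-∪⁅⁆⁻ (root-hubs desc y∈Hx)
  ... | inj₁ y∈Anc = inj₁ y∈Anc
  ... | inj₂ refl  = inj₂ x∈S
  hub-of-chosen desc (there {p = r∈S} C C-comp ch) y∈Hx
    with hub-of-chosen (Descent-child desc C-comp) ch y∈Hx
  ... | inj₂ y∈C = inj₂ (component⊆parent C-comp y∈C)
  ... | inj₁ y∈Anc∪r with ∈-∪⁅⁆⁻ y∈Anc∪r
  ...   | inj₁ y∈Anc = inj₁ y∈Anc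
  ...   | inj₂ refl  = inj₂ r∈S

  hub-stays-in-component : ∀ {S Anc r r∈S sub} → Descent Anc (node {S = S} r r∈S sub) →
                           ∀ {C} → IsComponent G C (S - r) → ∀ {w x} →
                           w ∈ C → w ∉ Anc → x ∈ S - r → w ∈ H x → x ∈ C
  hub-stays-in-component {S} {Anc} {r} {sub = sub} desc {C} C-comp {w} {x} w∈C w∉Anc x∈S-r w∈Hx =
    meet (hub-of-chosen (Descent-child desc Cₓ-comp) (chosen-exists (sub _ Cₓ-comp) x∈Cₓ .proj₂) w∈Hx)
    where
    x∈Cₓ : x ∈ componentOf (S - r) x
    x∈Cₓ = ∈componentOf-self x∈S-r
    Cₓ-comp : IsComponent G (componentOf (S - r) x) (S - r)
    Cₓ-comp = componentOf-isComponent x∈Cₓ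
    meet : w ∈ Anc ∪ ⁅ r ⁆ ⊎ w ∈ componentOf (S - r) x → x ∈ C
    meet (inj₁ w∈Anc∪r) = ⊥-elim (∉-∪⁅⁆ w∉Anc (λ { refl → component∌removed C-comp w∈C }) w∈Anc∪r)
    meet (inj₂ w∈Cₓ)    = components-meet⇒⊆ Cₓ-comp C-comp w∈Cₓ w∈C x∈Cₓ

  hub⇒∈subtree : ∀ {S Anc} {Dₛ : Decomposition G S} {w T x} → Descent Anc Dₛ → w ∉ Anc → x ∈ S →
                 Chosen G Dₛ w T → w ∈ H x → x ∈ T
  hub⇒∈subtree _ _ x∈S here _ = x∈S
  hub⇒∈subtree {Anc = Anc} {w = w} {x = x} desc w∉Anc x∈S (there {r = r} C C-comp ch) w∈Hx =
    hub⇒∈subtree (Descent-child desc C-comp) w∉Anc∪r x∈C ch w∈Hx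
    where
    w∈C : w ∈ C
    w∈C = chosen⊆ ch .proj₂ (chosen⊆ ch .proj₁)
    w∉Anc∪r : w ∉ Anc ∪ ⁅ r ⁆
    w∉Anc∪r = ∉-∪⁅⁆ w∉Anc (λ { refl → component∌removed C-comp w∈C })
    x∈C : x ∈ C
    x∈C with x ≟ r
    ... | yes refl = ⊥-elim (w∉Anc∪r (root-hubs desc w∈Hx))
    ... | no  x≢r  = hub-stays-in-component desc C-comp w∈C w∉Anc (Subset.x∈p∧x≢y⇒x∈p-y x∈S x≢r) w∈Hx

  -- d may decompose a component differently for different proofs that it is one, so uniqueness
  -- of T_u is not structural: it rests on root-hubs, i.e. on optimality.
  Chosen-unique : ∀ {u T₁ T₂} → Chosen G d u T₁ → Chosen G d u T₂ → T₁ ≡ T₂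
  Chosen-unique ch₁ ch₂ = Subset.⊆-antisym (⊆-of ch₁ ch₂) (⊆-of ch₂ ch₁)
    where
    ⊆-of : ∀ {u T T′} → Chosen G d u T → Chosen G d u T′ → T ⊆ T′
    ⊆-of ch ch′ y∈T =
      hub⇒∈subtree Descent-root Subset.∉⊥ Subset.∈⊤ ch′ (hub⇒∈H Descent-root (chosen⇒hub ch y∈T))

  module Exchange {S Anc r r∈S sub} (desc : Descent Anc (node {S = S} r r∈S sub))
                  {C} (C-comp : IsComponent G C (S - r)) {r′} (r′∈C : r′ ∈ C)
                  (r′-hub : ∀ {w} → w ∈ C → r′ ∈ H w) where

    private
      C⊆S : ∀ {y} → y ∈ C → y ∈ S
      C⊆S = component⊆parent C-comp

      neighbour : ∃ λ x → x ∈ C × Adj G x r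
      neighbour = component-neighbour C-comp (convex desc r∈S (C⊆S r′∈C)) r′∈C

      x : Fin n
      x = proj₁ neighbour

    X A R : Subset n
    X = componentOf (C - r′) x
    A = S ─ C
    R = C ─ X

    private
      R⊆C : ∀ {a} → a ∈ R → a ∈ C
      R⊆C = Subset.p─q⊆p C X

      r′∈path-x : ∀ {a} → a ∈ R → r′ ∈ₗ path a x
      r′∈path-x {a} a∈R with x ≟ r′
      ... | yes x≡r′ = subst (_∈ₗ path a x) x≡r′ (last∈ (path-walk a x))
      ... | no  x≢r′ = ∈path-sym (leaving-component⇒∈path (componentOf-isComponent x∈X) x∈X a∈C a∉X
                                    (component-convex C-comp x∈C a∈C))
        where
        x∈C : x ∈ C
        x∈C = neighbour .proj₂ .proj₁
        a∈C : a ∈ C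
        a∈C = R⊆C a∈R
        a∉X : a ∉ X
        a∉X = x∈p─q⇒x∉q a∈R
        x∈X : x ∈ X
        x∈X = ∈componentOf-self (Subset.x∈p∧x≢y⇒x∈p-y x∈C x≢r′)

      r⇒r′ : ∀ {a b} → a ∈ R → r ∈ₗ path a b → r′ ∈ₗ path a b
      r⇒r′ {a} a∈R r∈path =
        ∈path-prefix r∈path (subst (r′ ∈ₗ_) (path-∷ʳ x~r r∉path-x) (∈-++⁺ˡ (r′∈path-x a∈R)))
        where
        x~r : Adj G x r
        x~r = neighbour .proj₂ .proj₂
        r∉path-x : r ∉ₗ path a x
        r∉path-x r∈ = component∌removed C-comp
          (All.lookup (component-convex C-comp (R⊆C a∈R) (neighbour .proj₂ .proj₁)) r∈)

      row : ∀ w → Dec (w ∈ A) → Dec (w ∈ R) → Subset n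
      row w (yes _) _       = H w ∪ ⁅ r′ ⁆
      row w (no _)  (yes _) = H w - r
      row w (no _)  (no _)  = H w

      H′ : Fin n → Subset n
      H′ w = row w (w Subset.∈? A) (w Subset.∈? R)

      keep : ∀ {w h} → h ∈ H w → h ≢ r → h ∈ H′ w
      keep {w} = go (w Subset.∈? A) (w Subset.∈? R)
        where
        go : ∀ {h} dA dR → h ∈ H w → h ≢ r → h ∈ row w dA dR
        go (yes _) _       h∈Hw _   = Subset.p⊆p∪q ⁅ r′ ⁆ h∈Hw
        go (no _)  (yes _) h∈Hw h≢r = Subset.x∈p∧x≢y⇒x∈p-y h∈Hw h≢r
        go (no _)  (no _)  h∈Hw _   = h∈Hw

      keep-r : ∀ {w} → r ∈ H w → w ∉ R → r ∈ H′ w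
      keep-r {w} = go (w Subset.∈? A) (w Subset.∈? R)
        where
        go : ∀ dA dR → r ∈ H w → w ∉ R → r ∈ row w dA dR
        go (yes _) _         r∈Hw _   = Subset.p⊆p∪q ⁅ r′ ⁆ r∈Hw
        go (no _)  (yes w∈R) _    w∉R = ⊥-elim (w∉R w∈R)
        go (no _)  (no _)    r∈Hw _   = r∈Hw

      add-r′ : ∀ {w} → w ∈ A → r′ ∈ H′ w
      add-r′ {w} = go (w Subset.∈? A) (w Subset.∈? R)
        where
        go : ∀ dA dR → w ∈ A → r′ ∈ row w dA dR
        go (yes _)  _ _   = Subset.q⊆p∪q (H w) ⁅ r′ ⁆ (Subset.x∈⁅x⁆ r′)
        go (no w∉A) _ w∈A = ⊥-elim (w∉A w∈A)

      rerouted : ∀ {a b} → a ∈ R → r ∈ H b → r ∈ₗ path a b →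
                 ∃ λ h → h ∈ H′ a × h ∈ H′ b × h ∈ₗ path a b
      rerouted {a} {b} a∈R r∈Hb r∈path with b Subset.∈? S | b Subset.∈? C
      ... | _ | yes b∈C =
        ⊥-elim (component∌removed C-comp (All.lookup (component-convex C-comp (R⊆C a∈R) b∈C) r∈path))
      ... | yes b∈S | no b∉C =
        r′ , keep (r′-hub (R⊆C a∈R)) (x∈p-y⇒x≢y (component⊆ C-comp r′∈C)) ,
             add-r′ (Subset.x∈p∧x∉q⇒x∈p─q b∈S b∉C) , r⇒r′ a∈R r∈path
      ... | no b∉S | _ with separated desc (C⊆S (R⊆C a∈R)) b∉S
      ...   | h , _ , h∈Ha , h∈Hb , h∈path , h∉S =
              h , keep h∈Ha h≢r , keep h∈Hb h≢r , h∈path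
        where
        h≢r : h ≢ r
        h≢r refl = h∉S r∈S

      H′-hub : IsHubLabeling G H′
      H′-hub a b with proj₁ optimal a b
      ... | h , h∈Ha , h∈Hb , on-path with h ≟ r
      ...   | no h≢r   = h , keep h∈Ha h≢r , keep h∈Hb h≢r , on-path
      ...   | yes refl = via-r (a Subset.∈? R) (b Subset.∈? R) h∈Ha h∈Hb (OnPath⇒∈path on-path)
        where
        via-r : Dec (a ∈ R) → Dec (b ∈ R) → r ∈ H a → r ∈ H b → r ∈ₗ path a b →
                ∃ λ h → h ∈ H′ a × h ∈ H′ b × OnPath G a b h
        via-r (yes a∈R) _ _ r∈Hb r∈path with rerouted a∈R r∈Hb r∈path
        ... | h , h∈H′a , h∈H′b , h∈path = h , h∈H′a , h∈H′b , ∈path⇒OnPath h∈path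
        via-r (no _) (yes b∈R) r∈Ha _ r∈path with rerouted b∈R r∈Ha (∈path-sym r∈path)
        ... | h , h∈H′b , h∈H′a , h∈path = h , h∈H′a , h∈H′b , ∈path⇒OnPath (∈path-sym h∈path)
        via-r (no a∉R) (no b∉R) r∈Ha r∈Hb r∈path =
          r , keep-r r∈Ha a∉R , keep-r r∈Hb b∉R , ∈path⇒OnPath r∈path

      row-cost : ∀ w → ∣ H′ w ∣ + ind (w Subset.∈? R) ≤ ∣ H w ∣ + ind (w Subset.∈? A)
      row-cost w = go (w Subset.∈? A) (w Subset.∈? R)
        where
        open ℕ.≤-Reasoning
        go : ∀ dA dR → ∣ row w dA dR ∣ + ind dR ≤ ∣ H w ∣ + ind dA
        go (yes w∈A) (yes w∈R) = ⊥-elim (x∈p─q⇒x∉q w∈A (R⊆C w∈R))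
        go (yes _)   (no _)    = begin
          ∣ H w ∪ ⁅ r′ ⁆ ∣ + 0   ≡⟨ ℕ.+-identityʳ _ ⟩
          ∣ H w ∪ ⁅ r′ ⁆ ∣       ≤⟨ ∣p∪q∣≤∣p∣+∣q∣ (H w) ⁅ r′ ⁆ ⟩
          ∣ H w ∣ + ∣ ⁅ r′ ⁆ ∣   ≡⟨ cong (∣ H w ∣ +_) (Subset.∣⁅x⁆∣≡1 r′) ⟩
          ∣ H w ∣ + 1            ∎
        go (no _)    (yes w∈R) = begin
          ∣ H w - r ∣ + 1        ≡⟨ ℕ.+-comm _ 1 ⟩
          suc ∣ H w - r ∣        ≤⟨ Subset.x∈p⇒∣p-x∣<∣p∣ (hub⇒∈H desc (here (C⊆S (R⊆C w∈R)))) ⟩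
          ∣ H w ∣                ≡⟨ ℕ.+-identityʳ _ ⟨
          ∣ H w ∣ + 0            ∎
        go (no _)    (no _)    = ℕ.≤-refl

    ∣R∣≤∣A∣ : ∣ R ∣ ≤ ∣ A ∣
    ∣R∣≤∣A∣ = subst₂ _≤_ (∑-ind R) (∑-ind A)
                (exchange-bound H′-hub (λ w → ind (w Subset.∈? R)) (λ w → ind (w Subset.∈? A)) row-cost)

    ∣C∣+∣C∣≤∣S∣+∣X∣ : ∣ C ∣ + ∣ C ∣ ≤ ∣ S ∣ + ∣ X ∣
    ∣C∣+∣C∣≤∣S∣+∣X∣ = begin
      ∣ C ∣ + ∣ C ∣              ≤⟨ ℕ.+-monoˡ-≤ ∣ C ∣ (∣p∣≤∣p─q∣+∣q∣ C X) ⟩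
      (∣ R ∣ + ∣ X ∣) + ∣ C ∣    ≤⟨ ℕ.+-monoˡ-≤ ∣ C ∣ (ℕ.+-monoˡ-≤ (∣ X ∣) ∣R∣≤∣A∣) ⟩
      (∣ A ∣ + ∣ X ∣) + ∣ C ∣    ≡⟨ xy∙z≈xz∙y (∣ A ∣) (∣ X ∣) (∣ C ∣) ⟩
      (∣ A ∣ + ∣ C ∣) + ∣ X ∣    ≤⟨ ℕ.+-monoˡ-≤ ∣ X ∣ ∣A∣+∣C∣≤∣S∣ ⟩
      ∣ S ∣ + ∣ X ∣              ∎
      where
      open ℕ.≤-Reasoning
      ∣A∣+∣C∣≤∣S∣ : ∣ A ∣ + ∣ C ∣ ≤ ∣ S ∣
      ∣A∣+∣C∣≤∣S∣ = disjoint⇒∣p∣+∣q∣≤∣s∣ (Subset.p─q⊆p S C) C⊆S x∈p─q⇒x∉q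

  M+∣C∣≤∣S∣ : ∀ {S Anc r r∈S sub} → Descent Anc (node {S = S} r r∈S sub) →
              ∀ {C Anc′} {D : Decomposition G C} → IsComponent G C (S - r) → Descent Anc′ D →
              ∀ {v Tv kv} → Chosen G D v Tv → LargestComp G Tv v kv → M G Tv kv + ∣ C ∣ ≤ ∣ S ∣

  M+∣X∣≤∣C∣ : ∀ {C Anc r′ r′∈C sub} → Descent Anc (node {S = C} r′ r′∈C sub) →
              ∀ {v Tv kv} → Chosen G (node {S = C} r′ r′∈C sub) v Tv → LargestComp G Tv v kv →
              ∀ {X} → IsComponent G X (C - r′) → M G Tv kv + ∣ X ∣ ≤ ∣ C ∣

  M+∣C∣≤∣S∣ desc {C} {D = node r′ r′∈C _} C-comp desc′ {Tv = Tv} {kv} ch largest =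
    m+o≤n⇒n+n≤p+o⇒m+n≤p M+∣X∣≤∣C∣′ (Exchange.∣C∣+∣C∣≤∣S∣+∣X∣ desc C-comp r′∈C r′-hub)
    where
    r′-hub : ∀ {w} → w ∈ C → r′ ∈ H w
    r′-hub w∈C = hub⇒∈H desc′ (here w∈C)
    X : Subset n
    X = Exchange.X desc C-comp r′∈C r′-hub
    M+∣X∣≤∣C∣′ : M G Tv kv + ∣ X ∣ ≤ ∣ C ∣
    M+∣X∣≤∣C∣′ with Subset.nonempty? X
    ... | yes (_ , y∈X) = M+∣X∣≤∣C∣ desc′ ch largest (componentOf-isComponent y∈X)
    ... | no  empty     = begin
      M G Tv kv + ∣ X ∣       ≡⟨ cong (λ Y → M G Tv kv + ∣ Y ∣) (Subset.Empty-unique empty) ⟩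
      M G Tv kv + ∣ ∅ {n} ∣   ≡⟨ cong (M G Tv kv +_) (Subset.∣⊥∣≡0 n) ⟩
      M G Tv kv + 0           ≡⟨ ℕ.+-identityʳ _ ⟩
      M G Tv kv               ≤⟨ M≤∣S∣ {k = kv} ch ⟩
      ∣ C ∣                   ∎
      where open ℕ.≤-Reasoning

  M+∣X∣≤∣C∣ desc here largest X-comp =
    m∸n+o≤m (largest-bound largest X-comp) (Subset.p⊆q⇒∣p∣≤∣q∣ (x∈p-y⇒x∈p ∘ component⊆ X-comp))
  M+∣X∣≤∣C∣ {C} {r′ = r′} {r′∈C} desc {Tv = Tv} {kv} (there C′ C′-comp ch) largest {X} X-comp
    with Subset.nonempty? (X ∩ C′)
  ... | yes (_ , y∈X∩C′) = begin
    M G Tv kv + ∣ X ∣    ≤⟨ ℕ.+-monoʳ-≤ (M G Tv kv) (Subset.p⊆q⇒∣p∣≤∣q∣ X⊆C′) ⟩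
    M G Tv kv + ∣ C′ ∣   ≤⟨ M+∣C∣≤∣S∣ desc C′-comp (Descent-child desc C′-comp) ch largest ⟩
    ∣ C ∣                ∎
    where
    open ℕ.≤-Reasoning
    X⊆C′ : X ⊆ C′
    X⊆C′ = components-meet⇒⊆ X-comp C′-comp (Subset.p∩q⊆p X C′ y∈X∩C′) (Subset.p∩q⊆q X C′ y∈X∩C′)
  ... | no  disjoint     = begin
    M G Tv kv + ∣ X ∣    ≤⟨ ℕ.+-monoˡ-≤ ∣ X ∣ (M≤∣S∣ {k = kv} ch) ⟩
    ∣ C′ ∣ + ∣ X ∣       ≡⟨ ℕ.+-comm ∣ C′ ∣ ∣ X ∣ ⟩
    ∣ X ∣ + ∣ C′ ∣       ≤⟨ disjoint⇒∣p∣+∣q∣≤∣s∣ (component⊆ X-comp) (component⊆ C′-comp)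
                              (λ y∈X y∈C′ → disjoint (_ , Subset.x∈p∩q⁺ (y∈X , y∈C′))) ⟩
    ∣ C - r′ ∣           ≤⟨ ℕ.<⇒≤ (Subset.x∈p⇒∣p-x∣<∣p∣ r′∈C) ⟩
    ∣ C ∣                ∎
    where open ℕ.≤-Reasoning

  M-below-root : ∀ {S Anc u u∈S sub} → Descent Anc (node {S = S} u u∈S sub) →
                 ∀ {C} (C-comp : IsComponent G C (S - u)) →
                 ∀ {v Tv ku kv} → Chosen G (sub C C-comp) v Tv →
                 LargestComp G S u ku → LargestComp G Tv v kv → M G Tv kv ≤ M G S ku
  M-below-root desc {C} C-comp ch (inj₂ (none , _)) _ = ⊥-elim (none C C-comp)
  M-below-root {S} {u = u} desc {C} C-comp {v} {Tv} {kv = kv} ch (inj₁ (L , L-comp , refl , _))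
               largest-v =
    ℕ.m+n≤o⇒m≤o∸n (M G Tv kv) M+∣L∣≤∣S∣
    where
    open ℕ.≤-Reasoning
    v∈C : v ∈ C
    v∈C = chosen⊆ ch .proj₂ (chosen⊆ ch .proj₁)
    M+∣L∣≤∣S∣ : M G Tv kv + ∣ L ∣ ≤ ∣ S ∣
    M+∣L∣≤∣S∣ with v Subset.∈? L
    ... | yes v∈L = begin
      M G Tv kv + ∣ L ∣   ≤⟨ ℕ.+-monoʳ-≤ (M G Tv kv) (Subset.p⊆q⇒∣p∣≤∣q∣ L⊆C) ⟩
      M G Tv kv + ∣ C ∣   ≤⟨ M+∣C∣≤∣S∣ desc C-comp (Descent-child desc C-comp) ch largest-v ⟩
      ∣ S ∣               ∎
      where
      L⊆C : L ⊆ C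
      L⊆C = components-meet⇒⊆ L-comp C-comp v∈L v∈C
    ... | no  v∉L = begin
      M G Tv kv + ∣ L ∣   ≤⟨ ℕ.+-monoˡ-≤ ∣ L ∣ (M≤∣S∣ {k = kv} ch) ⟩
      ∣ C ∣ + ∣ L ∣       ≤⟨ disjoint⇒∣p∣+∣q∣≤∣s∣ (component⊆ C-comp) (component⊆ L-comp)
                               (λ y∈C y∈L → v∉L (components-meet⇒⊆ C-comp L-comp y∈C y∈L v∈C)) ⟩
      ∣ S - u ∣           ≤⟨ Subset.∣p─q∣≤∣p∣ S ⁅ u ⁆ ⟩
      ∣ S ∣               ∎

  M-antitone : ∀ {S Anc} {Dₛ : Decomposition G S} → Descent Anc Dₛ →
               ∀ {u v} → u ∉ Anc → u ∈ H v → u ≢ v →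
               ∀ {Tu Tv ku kv} → Chosen G d u Tu → Chosen G Dₛ v Tv →
               LargestComp G Tu u ku → LargestComp G Tv v kv → M G Tv kv ≤ M G Tu ku
  M-antitone desc u∉Anc u∈Hv u≢v _ here _ _ = ⊥-elim (∉-∪⁅⁆ u∉Anc u≢v (root-hubs desc u∈Hv))
  M-antitone desc {u} u∉Anc u∈Hv u≢v chu (there {r = r} C C-comp ch) largest-u largest-v with u ≟ r
  ... | no u≢r =
    M-antitone (Descent-child desc C-comp) (∉-∪⁅⁆ u∉Anc u≢r) u∈Hv u≢v chu ch largest-u largest-v
  ... | yes refl with Chosen-unique chu (chosen⇒chosen desc here)
  ...   | refl = M-below-root desc C-comp ch largest-u largest-v

mainTheorem6 : ∀ {n} (G : Graph n) → IsTree G →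
    (H : Fin n → Subset n) (d : Decomposition G ⊤) → Produces G d H →
    HL₁-optimal G H →
    ∀ u v → u ∈ H v → u ≢ v →
    ∀ Tu Tv → Chosen G d u Tu → Chosen G d v Tv →
    ∀ ku kv → LargestComp G Tu u ku → LargestComp G Tv v kv →
    M G Tv kv ≤ M G Tu ku
mainTheorem6 G tree H d produces optimal _ _ u∈Hv u≢v _ _ chu chv _ _ largest-u largest-v =
  M-antitone Descent-root Subset.∉⊥ u∈Hv u≢v chu chv largest-u largest-v
  where open OptimalDecomposition G tree H d produces optimal
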